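{- For each $v\in\{64,100,112\}$ there exists a super-simple $(v,4,2)$DD with $d\ge\frac12$.
   Context: A $(v,4,2)$DD is a pair $(X,\mathcal{B})$ with $|X|=v$ and $\mathcal{B}$ a collection of ordered $4$-tuples of distinct points (blocks) such that every ordered pair $(x,y)$ of distinct points appears in exactly $2$ blocks, where $(x,y)$ appears in $(a_1,\dots,a_4)$ if $x=a_i,y=a_j$ with $i<j$. It is super-simple if any two blocks, viewed as sets, share at most two points. A defining set is a subset of $\mathcal{B}$ contained in a unique $(v,4,2)$DD on $X$; $d$ is the size of a smallest defining set divided by $|\mathcal{B}|$. -}

module Defs where

open import Data.Nat using (ℕ; _≤_; _*_)
open import Data.Fin using (Fin)
open import Data.Fin.Properties using () renaming (_≟_ to _≟F_)
open import Data.Vec using (Vec; _∷_; []; lookup; toList)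
open import Data.Vec.Properties using (≡-dec)
open import Data.List using (List; length; filter; _∷_; [])
open import Data.List.Membership.Propositional using (_∈_)
open import Data.Product using (_×_; _,_)
open import Data.Product.Properties using () renaming (≡-dec to ×-≡-dec)
open import Relation.Binary.PropositionalEquality using (_≡_; _≢_)
open import Relation.Binary.Definitions using (DecidableEquality)
import Data.List.Membership.DecPropositional as DecMem

Block : ℕ → Set
Block v = Vec (Fin v) 4

_≟B_ : ∀ {v} → DecidableEquality (Block v)
_≟B_ = ≡-dec _≟F_

_≟P_ : ∀ {v} → DecidableEquality (Fin v × Fin v)
_≟P_ = ×-≡-dec _≟F_ _≟F_

DistinctPoints : ∀ {v} → Block v → Set
DistinctPoints b = ∀ (i j : Fin 4) → i ≢ j → lookup b i ≢ lookup b j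

orderedPairs : ∀ {v} → Block v → List (Fin v × Fin v)
orderedPairs (a₁ ∷ a₂ ∷ a₃ ∷ a₄ ∷ []) =
  (a₁ , a₂) ∷ (a₁ , a₃) ∷ (a₁ , a₄) ∷ (a₂ , a₃) ∷ (a₂ , a₄) ∷ (a₃ , a₄) ∷ []

pairCount : ∀ {v} → Fin v → Fin v → List (Block v) → ℕ
pairCount x y B = length (filter (λ b → DecMem._∈?_ _≟P_ (x , y) (orderedPairs b)) B)

-- (v,4,2) directed design on X = Fin v, with block collection B (a multiset, given as a list).
IsDD : (v : ℕ) → List (Block v) → Set
IsDD v B =
  (∀ b → b ∈ B → DistinctPoints b) ×
  (∀ (x y : Fin v) → x ≢ y → pairCount x y B ≡ 2)

commonPoints : ∀ {v} → Block v → Block v → ℕ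
commonPoints b c = length (filter (λ x → DecMem._∈?_ _≟F_ x (toList c)) (toList b))

SuperSimple : ∀ {v} → List (Block v) → Set
SuperSimple B = ∀ (i j : Fin (length B)) → i ≢ j →
  commonPoints (Data.List.lookup B i) (Data.List.lookup B j) ≤ 2
  where import Data.List

mult : ∀ {v} → Block v → List (Block v) → ℕ
mult b B = length (filter (b ≟B_) B)

_⊑_ : ∀ {v} → List (Block v) → List (Block v) → Set
S ⊑ B = ∀ b → mult b S ≤ mult b B

_≈ₘ_ : ∀ {v} → List (Block v) → List (Block v) → Set
B ≈ₘ B' = ∀ b → mult b B ≡ mult b B'

IsDefiningSet : (v : ℕ) → List (Block v) → List (Block v) → Set
IsDefiningSet v B S = (S ⊑ B) × (∀ B' → IsDD v B' → S ⊑ B' → B' ≈ₘ B)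

-- d ≥ 1/2 : the smallest defining set has size at least |B|/2,
-- i.e. every defining set S satisfies |B| ≤ 2 |S|.
HalfDefining : (v : ℕ) → List (Block v) → Set
HalfDefining v B = ∀ S → IsDefiningSet v B S → length B ≤ 2 * length S

-- Each design is a union of trades {(a,b,c,d), (b,a,e,f)}: the blocks (b,a,c,d), (a,b,e,f)
-- cover every ordered pair exactly as often, so a set of blocks avoiding both blocks of a trade
-- also lies in the directed design obtained by the swap, and cannot be defining. A defining set
-- therefore meets each of the |B|/2 trades, and as no block is repeated it has at least |B|/2
-- elements. The trades are the translates over ℤ_v of a few base trades; that their union is a
-- super-simple DD is checked by computation on integer codes: sorted, the codes of the ordered
-- pairs covered by the blocks are those of all pairs of distinct points, each twice, and the
-- codes of the 3-subsets of the blocks are strictly increasing.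

module Submission where

open import Defs
open import Algebra.Properties.CommutativeSemigroup using (interchange)
open import Data.Bool using (true)
open import Data.Fin using (Fin; toℕ)
open import Data.Fin.Patterns using (0F; 1F; 2F; 3F)
open import Data.Fin.Properties using (suc-injective; toℕ-injective; toℕ-combine; combine-injective)
  renaming (_≟_ to _≟F_)
open import Data.List
  using (List; []; _∷_; _++_; [_]; length; filter; map; concatMap; take; lookup; cartesianProduct; allFin; upTo)
open import Data.List.Properties
  using (length-take; length-++; filter-++; filter-accept; filter-reject; filter-none; map-++; concatMap-++; ≡-dec)
import Data.List.Membership.DecPropositional as DecMem
open import Data.List.Membership.Propositional using (_∈_; _∉_; lose)
open import Data.List.Membership.Propositional.Properties
  using (∈-map⁺; ∈-filter⁺; ∈-filter⁻; ∈-cartesianProduct⁺; ∈-allFin; ∈-lookup; ∈-concatMap⁺; ∈-++⁻; ∈-++⁺ˡ; ∈-++⁺ʳ; ∈-∃++)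
open import Data.List.Relation.Binary.Permutation.Propositional
  using (_↭_; ↭-refl; ↭-sym; ↭-trans; ↭-prep; ↭-swap; module PermutationReasoning)
open import Data.List.Relation.Binary.Permutation.Propositional.Properties
  using (↭-length; filter-↭; ∈-resp-↭; shift; shifts; ++⁺; ++⁺ˡ; map⁺)
open import Data.List.Relation.Binary.Subset.Propositional using (_⊆_)
open import Data.List.Relation.Unary.All using (All; []; _∷_; all?)
import Data.List.Relation.Unary.All as All
import Data.List.Relation.Unary.All.Properties as All
open import Data.List.Relation.Unary.All.Properties using (¬Any⇒All¬; All¬⇒¬Any)
open import Data.List.Relation.Unary.AllPairs using ([]; _∷_)
import Data.List.Relation.Unary.AllPairs as AllPairs
open import Data.List.Relation.Unary.Any using (Any; here; there; any?)
open import Data.List.Relation.Unary.Linked using (Linked; linked?)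
open import Data.List.Relation.Unary.Linked.Properties using (Linked⇒AllPairs)
open import Data.List.Relation.Unary.Unique.Propositional using (Unique)
import Data.List.Relation.Unary.Unique.Propositional.Properties as Unique
open import Data.Nat using (ℕ; suc; _+_; _*_; _∸_; _≤_; _<_; _≤?_; _<?_; z≤n; s≤s; NonZero; nonZero)
open import Data.Nat.DivMod using (_mod_)
open import Data.Nat.ListAction using (sum)
open import Data.Nat.ListAction.Properties using (sum-++; sum-↭)
open import Data.Nat.Properties
  using (≤-reflexive; ≤-trans; ≤-antisym; <-trans; <⇒≢; ≮⇒≥; ≰⇒>; n≮n; n<1⇒n≡0; +-mono-≤; +-monoʳ-≤;
         m≤m+n; m≤n+m; m≤n⇒m⊓n≡m; *-suc; *-monoʳ-≤; +-comm; +-cancelˡ-≡; +-cancelʳ-≡; m+n∸n≡m; +-identityʳ;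
         +-commutativeSemigroup; ≤-decTotalOrder; module ≤-Reasoning)
  renaming (_≟_ to _≟ℕ_)
open import Data.List.Sort.MergeSort.Base ≤-decTotalOrder using (sort)
open import Data.List.Sort.MergeSort.Properties ≤-decTotalOrder using (sort-↭)
open import Data.Product using (Σ; ∃-syntax; _×_; _,_; proj₁; proj₂)
open import Data.Sum using (_⊎_; inj₁; inj₂)
open import Data.Vec using (Vec; _∷_; []; toList)
import Data.Vec as Vec
open import Data.Vec.Properties using (length-toList)
import Data.Vec.Relation.Unary.All.Properties as VecAll
import Data.Vec.Relation.Unary.AllPairs as VecAllPairs
open import Data.Vec.Relation.Unary.All using ([]; _∷_)
open import Data.Vec.Relation.Unary.AllPairs using ([]; _∷_)
open import Data.Vec.Relation.Unary.Unique.Propositional using () renaming (Unique to UniqueVec)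
open import Data.Vec.Relation.Unary.Unique.Propositional.Properties using (lookup-injective)
open import Function using (_∘_)
open import Relation.Binary.Definitions using (DecidableEquality)
open import Relation.Binary.PropositionalEquality
  using (_≡_; _≢_; refl; sym; trans; cong; cong₂; subst; module ≡-Reasoning)
open import Relation.Nullary using (Dec; yes; no; does; ¬?; _×-dec_; contradiction)
import Relation.Nullary.Decidable as Dec

module Counting {A : Set} (_≟_ : DecidableEquality A) where

  -- For _≟B_ this is mult from Defs, definitionally.
  count : A → List A → ℕ
  count x xs = length (filter (x ≟_) xs)

  count-++ : ∀ x xs ys → count x (xs ++ ys) ≡ count x xs + count x ys
  count-++ x xs ys = trans (cong length (filter-++ (x ≟_) xs ys)) (length-++ (filter (x ≟_) xs))

  count-↭ : ∀ x {xs ys} → xs ↭ ys → count x xs ≡ count x ys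
  count-↭ x p = ↭-length (filter-↭ (x ≟_) p)

  count-head : ∀ x xs → count x (x ∷ xs) ≡ suc (count x xs)
  count-head x xs = cong length (filter-accept (x ≟_) refl)

  count-other : ∀ {x y} xs → x ≢ y → count x (y ∷ xs) ≡ count x xs
  count-other {x} xs x≢y = cong length (filter-reject (x ≟_) x≢y)

  count-∉ : ∀ {x xs} → x ∉ xs → count x xs ≡ 0
  count-∉ {x} x∉xs = cong length (filter-none (x ≟_) (¬Any⇒All¬ _ x∉xs))

  count-singleton-sym : ∀ x y → count x [ y ] ≡ count y [ x ]
  count-singleton-sym x y = by-cases (x ≟ y)
    where
    by-cases : Dec (x ≡ y) → count x [ y ] ≡ count y [ x ]
    by-cases (yes refl) = refl
    by-cases (no x≢y) = trans (count-other [] x≢y) (sym (count-other [] (x≢y ∘ sym)))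

  count-≤-∷ : ∀ x y xs → count x xs ≤ count x (y ∷ xs)
  count-≤-∷ x y xs = ≤-trans (m≤n+m _ (count x [ y ])) (≤-reflexive (sym (count-++ x [ y ] xs)))

  ∈⇒1≤count : ∀ {x xs} → x ∈ xs → 1 ≤ count x xs
  ∈⇒1≤count {x} {x ∷ xs} (here refl) = subst (1 ≤_) (sym (count-head x xs)) (s≤s z≤n)
  ∈⇒1≤count {x} {y ∷ xs} (there x∈xs) = ≤-trans (∈⇒1≤count x∈xs) (count-≤-∷ x y xs)

  Unique⇒count≤1 : ∀ x {xs} → Unique xs → count x xs ≤ 1
  Unique⇒count≤1 x {[]} [] = z≤n
  Unique⇒count≤1 x {y ∷ xs} (y∉xs ∷ unique) = by-cases (x ≟ y)
    where
    by-cases : Dec (x ≡ y) → count x (y ∷ xs) ≤ 1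
    by-cases (yes refl) = ≤-reflexive (trans (count-head x xs) (cong suc (count-∉ (All¬⇒¬Any y∉xs))))
    by-cases (no x≢y) = ≤-trans (≤-reflexive (count-other xs x≢y)) (Unique⇒count≤1 x unique)

  count-concatMap-two : ∀ {B : Set} (f : B → List A) {y} xs {i j : Fin (length xs)} → i ≢ j →
    y ∈ f (lookup xs i) → y ∈ f (lookup xs j) → 2 ≤ count y (concatMap f xs)
  count-concatMap-two f (x ∷ xs) {Fin.zero} {Fin.zero} i≢j _ _ = contradiction refl i≢j
  count-concatMap-two f {y} (x ∷ xs) {Fin.zero} {Fin.suc j} _ y∈i y∈j =
    ≤-trans (+-mono-≤ (∈⇒1≤count y∈i) (∈⇒1≤count (∈-concatMap⁺ f (lose (∈-lookup {xs = xs} j) y∈j))))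
            (≤-reflexive (sym (count-++ y (f x) (concatMap f xs))))
  count-concatMap-two f {y} (x ∷ xs) {Fin.suc i} {Fin.zero} _ y∈i y∈j =
    ≤-trans (+-mono-≤ (∈⇒1≤count y∈j) (∈⇒1≤count (∈-concatMap⁺ f (lose (∈-lookup {xs = xs} i) y∈i))))
            (≤-reflexive (sym (count-++ y (f x) (concatMap f xs))))
  count-concatMap-two f {y} (x ∷ xs) {Fin.suc i} {Fin.suc j} i≢j y∈i y∈j =
    ≤-trans (count-concatMap-two f xs (i≢j ∘ cong Fin.suc) y∈i y∈j)
            (≤-trans (m≤n+m _ (count y (f x))) (≤-reflexive (sym (count-++ y (f x) (concatMap f xs)))))

module _ {A B : Set} (_≟A_ : DecidableEquality A) (_≟B_ : DecidableEquality B) where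
  open Counting

  count-map : ∀ (f : A → B) → (∀ {x y} → f x ≡ f y → x ≡ y) →
    ∀ x xs → count _≟B_ (f x) (map f xs) ≡ count _≟A_ x xs
  count-map f f-injective x [] = refl
  count-map f f-injective x (y ∷ xs) = by-cases (x ≟A y)
    where
    by-cases : Dec (x ≡ y) → count _≟B_ (f x) (map f (y ∷ xs)) ≡ count _≟A_ x (y ∷ xs)
    by-cases (yes refl) = trans (count-head _≟B_ (f x) (map f xs))
      (trans (cong suc (count-map f f-injective x xs)) (sym (count-head _≟A_ x xs)))
    by-cases (no x≢y) = trans (count-other _≟B_ (map f xs) (x≢y ∘ f-injective))
      (trans (count-map f f-injective x xs) (sym (count-other _≟A_ xs x≢y)))

  count≤count-concatMap : ∀ (f : A → List B) {x y} → y ∈ f x →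
    ∀ xs → count _≟A_ x xs ≤ count _≟B_ y (concatMap f xs)
  count≤count-concatMap f y∈fx [] = z≤n
  count≤count-concatMap f {x} {y} y∈fx (z ∷ xs) = by-cases (x ≟A z)
    where
    bound : count _≟A_ x xs ≤ count _≟B_ y (concatMap f xs)
    bound = count≤count-concatMap f y∈fx xs
    by-cases : Dec (x ≡ z) → count _≟A_ x (z ∷ xs) ≤ count _≟B_ y (f z ++ concatMap f xs)
    by-cases (yes refl) = begin
      count _≟A_ x (x ∷ xs)                              ≡⟨ count-head _≟A_ x xs ⟩
      1 + count _≟A_ x xs                                ≤⟨ +-mono-≤ (∈⇒1≤count _≟B_ y∈fx) bound ⟩
      count _≟B_ y (f x) + count _≟B_ y (concatMap f xs) ≡⟨ count-++ _≟B_ y (f x) (concatMap f xs) ⟨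
      count _≟B_ y (f x ++ concatMap f xs)               ∎
      where open ≤-Reasoning
    by-cases (no x≢z) = begin
      count _≟A_ x (z ∷ xs)                              ≡⟨ count-other _≟A_ xs x≢z ⟩
      count _≟A_ x xs                                    ≤⟨ bound ⟩
      count _≟B_ y (concatMap f xs)                      ≤⟨ m≤n+m _ _ ⟩
      count _≟B_ y (f z) + count _≟B_ y (concatMap f xs) ≡⟨ count-++ _≟B_ y (f z) (concatMap f xs) ⟨
      count _≟B_ y (f z ++ concatMap f xs)               ∎
      where open ≤-Reasoning

does⇒witness : ∀ {P : Set} (d : Dec P) → does d ≡ true → P
does⇒witness (yes p) _ = p

Linked<⇒Unique : ∀ {xs} → Linked _<_ xs → Unique xs
Linked<⇒Unique = AllPairs.map <⇒≢ ∘ Linked⇒AllPairs <-trans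

module _ {A : Set} where

  take-⊆ : ∀ n (xs : List A) → take n xs ⊆ xs
  take-⊆ (suc n) (x ∷ xs) (here y≡x) = here y≡x
  take-⊆ (suc n) (x ∷ xs) (there y∈) = there (take-⊆ n xs y∈)

  ∈⇒↭∷ : ∀ {x : A} {xs} → x ∈ xs → ∃[ ys ] xs ↭ x ∷ ys
  ∈⇒↭∷ x∈xs with ys , zs , refl ← ∈-∃++ x∈xs = ys ++ zs , shift _ ys zs

  Unique⊆⇒↭++ : ∀ {xs ys : List A} → Unique ys → ys ⊆ xs → ∃[ zs ] xs ↭ ys ++ zs
  Unique⊆⇒↭++ {xs} {[]} _ _ = xs , ↭-refl
  Unique⊆⇒↭++ {xs} {y ∷ ys} (y∉ys ∷ unique) y∷ys⊆xs
    with zs , xs↭ys++zs ← Unique⊆⇒↭++ unique (y∷ys⊆xs ∘ there)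
    with ∈-++⁻ ys (∈-resp-↭ xs↭ys++zs (y∷ys⊆xs (here refl)))
  ... | inj₁ y∈ys = contradiction y∈ys (All¬⇒¬Any y∉ys)
  ... | inj₂ y∈zs with ws , zs↭y∷ws ← ∈⇒↭∷ y∈zs =
    ws , ↭-trans xs↭ys++zs (↭-trans (++⁺ˡ ys zs↭y∷ws) (shift y ys ws))

  length≡1⇒singleton : ∀ {zs : List A} → length zs ≡ 1 → ∃[ w ] zs ≡ [ w ]
  length≡1⇒singleton {w ∷ []} refl = w , refl

  remaining-length : ∀ {xs ys zs : List A} → length xs ≡ suc (length ys) → xs ↭ ys ++ zs → length zs ≡ 1
  remaining-length {xs} {ys} {zs} |xs| xs↭ys++zs = +-cancelˡ-≡ (length ys) _ 1 (begin
    length ys + length zs ≡⟨ length-++ ys ⟨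
    length (ys ++ zs)     ≡⟨ ↭-length xs↭ys++zs ⟨
    length xs             ≡⟨ |xs| ⟩
    suc (length ys)       ≡⟨ +-comm 1 (length ys) ⟩
    length ys + 1         ∎)
    where open ≡-Reasoning

  module _ (g : A → ℕ) where

    weight : List A → ℕ
    weight xs = sum (map g xs)

    complementWeights : List A → List ℕ
    complementWeights xs = map (λ w → weight xs ∸ g w) xs

    weight-++ : ∀ xs ys → weight (xs ++ ys) ≡ weight xs + weight ys
    weight-++ xs ys = trans (cong sum (map-++ g xs ys)) (sum-++ (map g xs) (map g ys))

    weight-↭ : ∀ {xs ys} → xs ↭ ys → weight xs ≡ weight ys
    weight-↭ p = sum-↭ (map⁺ g p)

    complement-weight : ∀ {xs ys w} → xs ↭ ys ++ [ w ] → weight xs ∸ g w ≡ weight ys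
    complement-weight {xs} {ys} {w} xs↭ys++w = begin
      weight xs ∸ g w              ≡⟨ cong (_∸ g w) (weight-↭ xs↭ys++w) ⟩
      weight (ys ++ [ w ]) ∸ g w   ≡⟨ cong (_∸ g w) (weight-++ ys [ w ]) ⟩
      weight ys + (g w + 0) ∸ g w  ≡⟨ cong (λ n → weight ys + n ∸ g w) (+-identityʳ (g w)) ⟩
      weight ys + g w ∸ g w        ≡⟨ m+n∸n≡m (weight ys) (g w) ⟩
      weight ys                    ∎
      where open ≡-Reasoning

    weight∈complementWeights : ∀ {xs ys} → Unique ys → ys ⊆ xs → length xs ≡ suc (length ys) →
      weight ys ∈ complementWeights xs
    weight∈complementWeights {xs} {ys} unique ys⊆xs |xs|
      with zs , xs↭ys++zs ← Unique⊆⇒↭++ unique ys⊆xs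
      with w , refl ← length≡1⇒singleton {zs} (remaining-length {xs} {ys} {zs} |xs| xs↭ys++zs) =
      subst (_∈ complementWeights xs) (complement-weight xs↭ys++zs)
        (∈-map⁺ (λ w → weight xs ∸ g w) (∈-resp-↭ (↭-sym xs↭ys++zs) (∈-++⁺ʳ ys (here refl))))

module _ {A : Set} where

  lookup-distinct⇒Unique : ∀ {n} {xs : Vec A n} →
    (∀ i j → i ≢ j → Vec.lookup xs i ≢ Vec.lookup xs j) → UniqueVec xs
  lookup-distinct⇒Unique {xs = []} _ = []
  lookup-distinct⇒Unique {xs = x ∷ xs} distinct =
    VecAll.lookup⁻ (λ j → distinct Fin.zero (Fin.suc j) λ ())
      ∷ lookup-distinct⇒Unique (λ i j i≢j → distinct (Fin.suc i) (Fin.suc j) (i≢j ∘ suc-injective))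

  Unique-toList : ∀ {n} {xs : Vec A n} → UniqueVec xs → Unique (toList xs)
  Unique-toList [] = []
  Unique-toList (x∉xs ∷ unique) = VecAll.toList⁺ x∉xs ∷ Unique-toList unique

exchange : ∀ {A : Set} (x y : A) xs ys → x ∷ xs ++ y ∷ ys ↭ y ∷ xs ++ x ∷ ys
exchange x y xs ys = begin
  x ∷ xs ++ y ∷ ys  ↭⟨ ↭-prep x (shift y xs ys) ⟩
  x ∷ y ∷ xs ++ ys  ↭⟨ ↭-swap x y ↭-refl ⟩
  y ∷ x ∷ xs ++ ys  ↭⟨ ↭-prep y (↭-sym (shift x xs ys)) ⟩
  y ∷ xs ++ x ∷ ys  ∎
  where open PermutationReasoning

module _ {v : ℕ} where
  open Counting

  Unique⇒DistinctPoints : ∀ {b : Block v} → UniqueVec b → DistinctPoints b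
  Unique⇒DistinctPoints unique i j i≢j = i≢j ∘ lookup-injective unique i j

  distinctPoints? : (b : Block v) → Dec (DistinctPoints b)
  distinctPoints? b =
    Dec.map′ Unique⇒DistinctPoints lookup-distinct⇒Unique (VecAllPairs.allPairs? (λ x y → ¬? (x ≟F y)) b)

  DistinctPoints-swap : ∀ {x y z w : Fin v} →
    DistinctPoints (x ∷ y ∷ z ∷ w ∷ []) → DistinctPoints (y ∷ x ∷ z ∷ w ∷ [])
  DistinctPoints-swap {x} {y} {z} {w} δ with lookup-distinct⇒Unique {xs = x ∷ y ∷ z ∷ w ∷ []} δ
  ... | (x≢y ∷ x∉zw) ∷ y∉zw ∷ unique = Unique⇒DistinctPoints (((x≢y ∘ sym) ∷ y∉zw) ∷ x∉zw ∷ unique)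

  points-unique : ∀ {b : Block v} → DistinctPoints b → Unique (toList b)
  points-unique = Unique-toList ∘ lookup-distinct⇒Unique

  pairs-unique : ∀ {b : Block v} → DistinctPoints b → Unique (orderedPairs b)
  pairs-unique {a₁ ∷ a₂ ∷ a₃ ∷ a₄ ∷ []} δ =
    (snd a₂≢a₃ ∷ snd a₂≢a₄ ∷ fst a₁≢a₂ ∷ fst a₁≢a₂ ∷ fst a₁≢a₃ ∷ []) ∷
    (snd a₃≢a₄ ∷ fst a₁≢a₂ ∷ fst a₁≢a₂ ∷ fst a₁≢a₃ ∷ []) ∷
    (fst a₁≢a₂ ∷ fst a₁≢a₂ ∷ fst a₁≢a₃ ∷ []) ∷
    (snd a₃≢a₄ ∷ fst a₂≢a₃ ∷ []) ∷
    (fst a₂≢a₃ ∷ []) ∷ [] ∷ []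
    where
    a₁≢a₂ = δ 0F 1F (λ ())
    a₁≢a₃ = δ 0F 2F (λ ())
    a₂≢a₃ = δ 1F 2F (λ ())
    a₂≢a₄ = δ 1F 3F (λ ())
    a₃≢a₄ = δ 2F 3F (λ ())
    fst : ∀ {x x′ y y′ : Fin v} → x ≢ x′ → (x , y) ≢ (x′ , y′)
    fst x≢x′ = x≢x′ ∘ cong proj₁
    snd : ∀ {x x′ y y′ : Fin v} → y ≢ y′ → (x , y) ≢ (x′ , y′)
    snd y≢y′ = y≢y′ ∘ cong proj₂

  pairCount-++ : ∀ (x y : Fin v) B C → pairCount x y (B ++ C) ≡ pairCount x y B + pairCount x y C
  pairCount-++ x y B C = trans (cong length (filter-++ _ B C)) (length-++ (filter _ B))

  pairCount-block : ∀ x y b → DistinctPoints b → pairCount x y [ b ] ≡ count _≟P_ (x , y) (orderedPairs b)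
  pairCount-block x y b δ = by-cases (xy∈? b)
    where
    xy∈? : (c : Block v) → Dec ((x , y) ∈ orderedPairs c)
    xy∈? c = DecMem._∈?_ _≟P_ (x , y) (orderedPairs c)
    by-cases : Dec ((x , y) ∈ orderedPairs b) → pairCount x y [ b ] ≡ count _≟P_ (x , y) (orderedPairs b)
    by-cases (yes xy∈b) = trans (cong length (filter-accept xy∈? xy∈b))
      (≤-antisym (∈⇒1≤count _≟P_ xy∈b) (Unique⇒count≤1 _≟P_ (x , y) (pairs-unique {b = b} δ)))
    by-cases (no xy∉b) = trans (cong length (filter-reject xy∈? xy∉b)) (sym (count-∉ _≟P_ xy∉b))

  pairCount≡count : ∀ x y {B} → All DistinctPoints B →
    pairCount x y B ≡ count _≟P_ (x , y) (concatMap orderedPairs B)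
  pairCount≡count x y [] = refl
  pairCount≡count x y {b ∷ B} (δ ∷ δs) = begin
    pairCount x y (b ∷ B)                               ≡⟨ pairCount-++ x y [ b ] B ⟩
    pairCount x y [ b ] + pairCount x y B               ≡⟨ cong₂ _+_ (pairCount-block x y b δ) (pairCount≡count x y δs) ⟩
    count _≟P_ (x , y) (orderedPairs b)
      + count _≟P_ (x , y) (concatMap orderedPairs B)   ≡⟨ count-++ _≟P_ (x , y) (orderedPairs b) _ ⟨
    count _≟P_ (x , y) (concatMap orderedPairs (b ∷ B)) ∎
    where open ≡-Reasoning

  pairCount-middle : ∀ (x y : Fin v) X T Y →
    pairCount x y (X ++ T ++ Y) ≡ pairCount x y X + (pairCount x y T + pairCount x y Y)
  pairCount-middle x y X T Y = trans (pairCount-++ x y X (T ++ Y)) (cong (pairCount x y X +_) (pairCount-++ x y T Y))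

  mult-middle : ∀ (b : Block v) X T Y → mult b (X ++ T ++ Y) ≡ mult b X + (mult b T + mult b Y)
  mult-middle b X T Y = trans (count-++ _≟B_ b X (T ++ Y)) (cong (mult b X +_) (count-++ _≟B_ b T Y))

  IsDD-swap : ∀ X {T₁ T₂} Y → All DistinctPoints T₂ → (∀ x y → pairCount x y T₁ ≡ pairCount x y T₂) →
    IsDD v (X ++ T₁ ++ Y) → IsDD v (X ++ T₂ ++ Y)
  IsDD-swap X {T₁} {T₂} Y δ₂ same (δ , twice) = points , pairs
    where
    points : ∀ b → b ∈ X ++ T₂ ++ Y → DistinctPoints b
    points b b∈ with ∈-++⁻ X b∈
    ... | inj₁ b∈X = δ b (∈-++⁺ˡ b∈X)
    ... | inj₂ b∈T₂++Y with ∈-++⁻ T₂ b∈T₂++Y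
    ... | inj₁ b∈T₂ = All.lookup δ₂ b∈T₂
    ... | inj₂ b∈Y = δ b (∈-++⁺ʳ X (∈-++⁺ʳ T₁ b∈Y))
    pairs : ∀ x y → x ≢ y → pairCount x y (X ++ T₂ ++ Y) ≡ 2
    pairs x y x≢y = begin
      pairCount x y (X ++ T₂ ++ Y)                            ≡⟨ pairCount-middle x y X T₂ Y ⟩
      pairCount x y X + (pairCount x y T₂ + pairCount x y Y)  ≡⟨ cong (λ n → pairCount x y X + (n + pairCount x y Y)) (same x y) ⟨
      pairCount x y X + (pairCount x y T₁ + pairCount x y Y)  ≡⟨ pairCount-middle x y X T₁ Y ⟨
      pairCount x y (X ++ T₁ ++ Y)                            ≡⟨ twice x y x≢y ⟩
      2                                                       ∎
      where open ≡-Reasoning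

  Meets : List (Block v) → List (Block v) → Set
  Meets S T = Any (λ c → 1 ≤ mult c S) T

  definingSet-meets-trade : ∀ X {T₁ T₂} Y {S b} → IsDefiningSet v (X ++ T₁ ++ Y) S → IsDD v (X ++ T₂ ++ Y) →
    mult b T₁ < mult b T₂ → Meets S T₁
  definingSet-meets-trade X {T₁} {T₂} Y {S} {b} (S⊑B₁ , defines) dd₂ more
    with any? (λ c → 1 ≤? mult c S) T₁
  ... | yes hit = hit
  ... | no miss = contradiction (sym (cancel (defines _ dd₂ S⊑B₂ b))) (<⇒≢ more)
    where
    absent : ∀ {c} → c ∈ T₁ → mult c S ≡ 0
    absent c∈T₁ = n<1⇒n≡0 (≰⇒> (miss ∘ lose c∈T₁))
    S⊑B₂ : S ⊑ (X ++ T₂ ++ Y)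
    S⊑B₂ c with DecMem._∈?_ _≟B_ c T₁
    ... | yes c∈T₁ = subst (_≤ mult c (X ++ T₂ ++ Y)) (sym (absent c∈T₁)) z≤n
    ... | no c∉T₁ = begin
      mult c S                                   ≤⟨ S⊑B₁ c ⟩
      mult c (X ++ T₁ ++ Y)                      ≡⟨ mult-middle c X T₁ Y ⟩
      mult c X + (mult c T₁ + mult c Y)          ≡⟨ cong (λ n → mult c X + (n + mult c Y)) (count-∉ _≟B_ c∉T₁) ⟩
      mult c X + mult c Y                        ≤⟨ +-monoʳ-≤ (mult c X) (m≤n+m (mult c Y) (mult c T₂)) ⟩
      mult c X + (mult c T₂ + mult c Y)          ≡⟨ mult-middle c X T₂ Y ⟨
      mult c (X ++ T₂ ++ Y)                      ∎
      where open ≤-Reasoning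
    cancel : mult b (X ++ T₂ ++ Y) ≡ mult b (X ++ T₁ ++ Y) → mult b T₂ ≡ mult b T₁
    cancel eq = +-cancelʳ-≡ (mult b Y) _ _ (+-cancelˡ-≡ (mult b X) _ _
      (trans (sym (mult-middle b X T₂ Y)) (trans eq (mult-middle b X T₁ Y))))

record Trade (v : ℕ) : Set where
  constructor trade
  field a b c d e f : Fin v

module _ {v : ℕ} where
  open Counting

  original swapped : Trade v → List (Block v)
  original (trade a b c d e f) = (a ∷ b ∷ c ∷ d ∷ []) ∷ (b ∷ a ∷ e ∷ f ∷ []) ∷ []
  swapped (trade a b c d e f) = (b ∷ a ∷ c ∷ d ∷ []) ∷ (a ∷ b ∷ e ∷ f ∷ []) ∷ []

  pivot : Trade v → Block v
  pivot (trade a b c d e f) = b ∷ a ∷ c ∷ d ∷ []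

  ValidTrade : Trade v → Set
  ValidTrade t@(trade a b c d e f) = All DistinctPoints (original t) × (c , d) ≢ (e , f)

  validTrade? : (t : Trade v) → Dec (ValidTrade t)
  validTrade? t@(trade a b c d e f) = all? distinctPoints? (original t) ×-dec ¬? ((c , d) ≟P (e , f))

  swapped-distinctPoints : ∀ {t} → ValidTrade t → All DistinctPoints (swapped t)
  swapped-distinctPoints ((δ₁ ∷ δ₂ ∷ []) , _) = DistinctPoints-swap δ₁ ∷ DistinctPoints-swap δ₂ ∷ []

  pivot∉original : ∀ {t} → ValidTrade t → pivot t ∉ original t
  pivot∉original ((δ₁ ∷ _) , _) (here pivot≡first) = δ₁ 0F 1F (λ ()) (sym (cong Vec.head pivot≡first))
  pivot∉original (_ , cd≢ef) (there (here pivot≡second)) =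
    cd≢ef (cong (λ xs → Vec.lookup xs 2F , Vec.lookup xs 3F) pivot≡second)

  -- The swap reverses (a,b) in one block and (b,a) in the other, and permutes the other pairs.
  trade-pairs-↭ : ∀ t → concatMap orderedPairs (original t) ↭ concatMap orderedPairs (swapped t)
  trade-pairs-↭ (trade a b c d e f) = ↭-trans
    (exchange (a , b) (b , a) ((a , c) ∷ (a , d) ∷ (b , c) ∷ (b , d) ∷ (c , d) ∷ [])
                              ((b , e) ∷ (b , f) ∷ (a , e) ∷ (a , f) ∷ (e , f) ∷ []))
    (↭-prep (b , a) (++⁺ (shifts ((a , c) ∷ (a , d) ∷ []) ((b , c) ∷ (b , d) ∷ []) {(c , d) ∷ []})
      (↭-prep (a , b) (shifts ((b , e) ∷ (b , f) ∷ []) ((a , e) ∷ (a , f) ∷ []) {(e , f) ∷ []}))))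

  trade-pairCount : ∀ {t} → ValidTrade t → ∀ x y → pairCount x y (original t) ≡ pairCount x y (swapped t)
  trade-pairCount {t} valid@(δ₁ , _) x y = begin
    pairCount x y (original t)                            ≡⟨ pairCount≡count x y δ₁ ⟩
    count _≟P_ (x , y) (concatMap orderedPairs (original t)) ≡⟨ count-↭ _≟P_ (x , y) (trade-pairs-↭ t) ⟩
    count _≟P_ (x , y) (concatMap orderedPairs (swapped t))  ≡⟨ pairCount≡count x y (swapped-distinctPoints {t} valid) ⟨
    pairCount x y (swapped t)                             ∎
    where open ≡-Reasoning

  blocksOf : List (Trade v) → List (Block v)
  blocksOf = concatMap original

  definingSet-meets-original : ∀ pre t post {S} → ValidTrade t →
    IsDD v (blocksOf (pre ++ t ∷ post)) → IsDefiningSet v (blocksOf (pre ++ t ∷ post)) S →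
    Meets S (original t)
  definingSet-meets-original pre t post {S} valid dd defining =
    definingSet-meets-trade X Y {S} {pivot t} (subst (λ B → IsDefiningSet v B S) split defining)
      (IsDD-swap X Y (swapped-distinctPoints {t} valid) (trade-pairCount {t} valid) (subst (IsDD v) split dd)) more
    where
    X = blocksOf pre
    Y = blocksOf post
    split : blocksOf (pre ++ t ∷ post) ≡ X ++ original t ++ Y
    split = concatMap-++ original pre (t ∷ post)
    more : mult (pivot t) (original t) < mult (pivot t) (swapped t)
    more = subst (_< mult (pivot t) (swapped t)) (sym (count-∉ _≟B_ (pivot∉original {t} valid))) (∈⇒1≤count _≟B_ {pivot t} {swapped t} (here refl))

  definingSet-meets-originals : ∀ {ts S} → All ValidTrade ts → IsDD v (blocksOf ts) →
    IsDefiningSet v (blocksOf ts) S → All (λ t → Meets S (original t)) ts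
  definingSet-meets-originals {ts} {S} valid dd defining = All.tabulate meets
    where
    meets : ∀ {t} → t ∈ ts → Meets S (original t)
    meets {t} t∈ts with pre , post , ts≡ ← ∈-∃++ t∈ts =
      definingSet-meets-original pre t post {S} (All.lookup valid t∈ts)
        (subst (IsDD v ∘ blocksOf) ts≡ dd) (subst (λ ts → IsDefiningSet v (blocksOf ts) S) ts≡ defining)

  hits : List (Block v) → List (Block v) → ℕ
  hits S = weight (λ b → mult b S)

  Meets⇒1≤hits : ∀ {S L} → Meets S L → 1 ≤ hits S L
  Meets⇒1≤hits {S} {c ∷ L} (here hit) = ≤-trans hit (m≤m+n (mult c S) (hits S L))
  Meets⇒1≤hits {S} {c ∷ L} (there hit) = ≤-trans (Meets⇒1≤hits {S} {L} hit) (m≤n+m (hits S L) (mult c S))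

  trades≤hits : ∀ {S} ts → All (λ t → Meets S (original t)) ts → length ts ≤ hits S (blocksOf ts)
  trades≤hits [] [] = z≤n
  trades≤hits {S} (t ∷ ts) (hit ∷ hits′) = ≤-trans (+-mono-≤ (Meets⇒1≤hits {S} hit) (trades≤hits {S} ts hits′))
    (≤-reflexive (sym (weight-++ (λ b → mult b S) (original t) (blocksOf ts))))

  hits-[] : ∀ L → hits [] L ≡ 0
  hits-[] [] = refl
  hits-[] (b ∷ L) = hits-[] L

  hits-∷ : ∀ s S L → hits (s ∷ S) L ≡ mult s L + hits S L
  hits-∷ s S [] = refl
  hits-∷ s S (b ∷ L) = begin
    mult b (s ∷ S) + hits (s ∷ S) L                    ≡⟨ cong₂ _+_ (count-++ _≟B_ b [ s ] S) (hits-∷ s S L) ⟩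
    (mult b [ s ] + mult b S) + (mult s L + hits S L)  ≡⟨ cong (λ n → (n + mult b S) + (mult s L + hits S L)) (count-singleton-sym _≟B_ b s) ⟩
    (mult s [ b ] + mult b S) + (mult s L + hits S L)  ≡⟨ interchange +-commutativeSemigroup (mult s [ b ]) (mult b S) (mult s L) (hits S L) ⟩
    (mult s [ b ] + mult s L) + (mult b S + hits S L)  ≡⟨ cong (_+ (mult b S + hits S L)) (count-++ _≟B_ s [ b ] L) ⟨
    mult s (b ∷ L) + hits S (b ∷ L)                    ∎
    where open ≡-Reasoning

  hits≤length : ∀ S {L} → (∀ s → mult s L ≤ 1) → hits S L ≤ length S
  hits≤length [] {L} _ = ≤-reflexive (hits-[] L)
  hits≤length (s ∷ S) {L} once = ≤-trans (≤-reflexive (hits-∷ s S L)) (+-mono-≤ (once s) (hits≤length S {L} once))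

  length-blocksOf : ∀ ts → length (blocksOf ts) ≡ 2 * length ts
  length-blocksOf [] = refl
  length-blocksOf (t ∷ ts) = trans (cong (2 +_) (length-blocksOf ts)) (sym (*-suc 2 (length ts)))

  halfDefining : ∀ ts → All ValidTrade ts → IsDD v (blocksOf ts) → (∀ s → mult s (blocksOf ts) ≤ 1) →
    HalfDefining v (blocksOf ts)
  halfDefining ts valid dd once S defining = begin
    length (blocksOf ts)      ≡⟨ length-blocksOf ts ⟩
    2 * length ts             ≤⟨ *-monoʳ-≤ 2 (trades≤hits {S} ts (definingSet-meets-originals {ts} {S} valid dd defining)) ⟩
    2 * hits S (blocksOf ts)  ≤⟨ *-monoʳ-≤ 2 (hits≤length S {blocksOf ts} once) ⟩
    2 * length S              ∎
    where open ≤-Reasoning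

module _ {v : ℕ} where
  open Counting

  -- tᵢ + 2²⁴ tᵢ² + 2⁴⁸ tᵢ³ summed over a 3-set packs its first three power sums, which determine
  -- it by Newton's identities (for v ≤ 112 no carries occur). Soundness only uses that the code
  -- of a 3-set does not depend on the order of its points; injectivity makes the check succeed.
  pointCode : Fin v → ℕ
  pointCode x = t + 16777216 * (t * t) + 281474976710656 * (t * t * t)
    where t = toℕ x

  tripleCodes : Block v → List ℕ
  tripleCodes b = complementWeights pointCode (toList b)

  shared-tripleCode : ∀ {b d : Block v} → DistinctPoints b → 3 ≤ commonPoints b d →
    ∃[ c ] c ∈ tripleCodes b × c ∈ tripleCodes d
  shared-tripleCode {b} {d} δ 3≤common =
    weight pointCode triple ,
    weight∈complementWeights pointCode unique (proj₁ ∘ in-both) (trans (length-toList b) (cong suc (sym |triple|))) ,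
    weight∈complementWeights pointCode unique (proj₂ ∘ in-both) (trans (length-toList d) (cong suc (sym |triple|)))
    where
    ∈d? = λ x → DecMem._∈?_ _≟F_ x (toList d)
    common = filter ∈d? (toList b)
    triple = take 3 common
    |triple| : length triple ≡ 3
    |triple| = trans (length-take 3 common) (m≤n⇒m⊓n≡m 3≤common)
    unique : Unique triple
    unique = Unique.take⁺ 3 (Unique.filter⁺ ∈d? (points-unique {b = b} δ))
    in-both : ∀ {x} → x ∈ triple → x ∈ toList b × x ∈ toList d
    in-both = ∈-filter⁻ ∈d? ∘ take-⊆ 3 common

  superSimple : ∀ {B} → All DistinctPoints B → (∀ c → count _≟ℕ_ c (concatMap tripleCodes B) ≤ 1) →
    SuperSimple B
  superSimple {B} δs once i j i≢j = ≮⇒≥ λ 2<common →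
    let c , c∈i , c∈j = shared-tripleCode (All.lookup δs (∈-lookup i)) 2<common
    in n≮n 1 (≤-trans (count-concatMap-two _≟ℕ_ tripleCodes B i≢j c∈i c∈j) (once c))

  blocks-once : ∀ {B} → (∀ c → count _≟ℕ_ c (concatMap tripleCodes B) ≤ 1) → ∀ s → mult s B ≤ 1
  blocks-once {B} once s@(_ ∷ _) =
    ≤-trans (count≤count-concatMap _≟B_ _≟ℕ_ tripleCodes (here refl) B) (once _)

  pairCode : Fin v × Fin v → ℕ
  pairCode (x , y) = v * toℕ x + toℕ y

  pairCode-injective : ∀ {p q} → pairCode p ≡ pairCode q → p ≡ q
  pairCode-injective {x , y} {x′ , y′} eq
    with refl , refl ← combine-injective x y x′ y′
           (toℕ-injective (trans (toℕ-combine x y) (trans eq (sym (toℕ-combine x′ y′))))) = refl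

  offDiagonal : List (Fin v × Fin v)
  offDiagonal = filter (λ p → ¬? (proj₁ p ≟F proj₂ p)) (cartesianProduct (allFin v) (allFin v))

  offDiagonalCodes : List ℕ
  offDiagonalCodes = map pairCode offDiagonal

  offDiagonalCodes-once : ∀ {x y} → x ≢ y → count _≟ℕ_ (pairCode (x , y)) offDiagonalCodes ≡ 1
  offDiagonalCodes-once {x} {y} x≢y = ≤-antisym
    (Unique⇒count≤1 _≟ℕ_ _ (Unique.map⁺ pairCode-injective
      (Unique.filter⁺ _ (Unique.cartesianProduct⁺ (Unique.allFin⁺ v) (Unique.allFin⁺ v)))))
    (∈⇒1≤count _≟ℕ_ (∈-map⁺ pairCode (∈-filter⁺ _ (∈-cartesianProduct⁺ (∈-allFin x) (∈-allFin y)) x≢y)))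

  sortedPairCodes : List (Block v) → List ℕ
  sortedPairCodes B = sort (map pairCode (concatMap orderedPairs B))

  sortedTripleCodes : List (Block v) → List ℕ
  sortedTripleCodes B = sort (concatMap tripleCodes B)

  pairCount≡2 : ∀ {B} → All DistinctPoints B → sortedPairCodes B ≡ sort (offDiagonalCodes ++ offDiagonalCodes) →
    ∀ x y → x ≢ y → pairCount x y B ≡ 2
  pairCount≡2 {B} δs codes x y x≢y = begin
    pairCount x y B                                         ≡⟨ pairCount≡count x y δs ⟩
    count _≟P_ (x , y) pairs                                ≡⟨ count-map _≟P_ _≟ℕ_ pairCode pairCode-injective (x , y) pairs ⟨
    count _≟ℕ_ c (map pairCode pairs)                       ≡⟨ count-↭ _≟ℕ_ c (sort-↭ (map pairCode pairs)) ⟨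
    count _≟ℕ_ c (sort (map pairCode pairs))                ≡⟨ cong (count _≟ℕ_ c) codes ⟩
    count _≟ℕ_ c (sort (offDiagonalCodes ++ offDiagonalCodes)) ≡⟨ count-↭ _≟ℕ_ c (sort-↭ (offDiagonalCodes ++ offDiagonalCodes)) ⟩
    count _≟ℕ_ c (offDiagonalCodes ++ offDiagonalCodes)     ≡⟨ count-++ _≟ℕ_ c offDiagonalCodes offDiagonalCodes ⟩
    count _≟ℕ_ c offDiagonalCodes + count _≟ℕ_ c offDiagonalCodes ≡⟨ cong₂ _+_ (offDiagonalCodes-once x≢y) (offDiagonalCodes-once x≢y) ⟩
    2                                                       ∎
    where
    open ≡-Reasoning
    pairs = concatMap orderedPairs B
    c = pairCode (x , y)

  validTrades⇒points : ∀ {ts : List (Trade v)} → All ValidTrade ts → All DistinctPoints (blocksOf ts)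
  validTrades⇒points [] = []
  validTrades⇒points ((δ , _) ∷ valid) = All.++⁺ δ (validTrades⇒points valid)

  design-from-checks : ∀ ts →
    does (all? validTrade? ts) ≡ true →
    does (≡-dec _≟ℕ_ (sortedPairCodes (blocksOf ts)) (sort (offDiagonalCodes ++ offDiagonalCodes))) ≡ true →
    does (linked? _<?_ (sortedTripleCodes (blocksOf ts))) ≡ true →
    Σ (List (Block v)) (λ B → IsDD v B × SuperSimple B × HalfDefining v B)
  design-from-checks ts valid-check pairs-check triples-check =
    B , dd , superSimple δs triples-once , halfDefining ts valid dd (blocks-once {B = B} triples-once)
    where
    B = blocksOf ts
    valid = does⇒witness (all? validTrade? ts) valid-check
    δs = validTrades⇒points valid
    dd : IsDD v B
    dd = (λ b → All.lookup δs) ,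
      pairCount≡2 δs (does⇒witness (≡-dec _≟ℕ_ _ (sort (offDiagonalCodes ++ offDiagonalCodes))) pairs-check)
    triples-once : ∀ c → count _≟ℕ_ c (concatMap tripleCodes B) ≤ 1
    triples-once c = subst (_≤ 1) (count-↭ _≟ℕ_ c (sort-↭ (concatMap tripleCodes B)))
      (Unique⇒count≤1 _≟ℕ_ c (Linked<⇒Unique (does⇒witness (linked? _<?_ (sortedTripleCodes B)) triples-check)))

module CyclicDevelopment (v : ℕ) .{{_ : NonZero v}} where

  point : ℕ → Fin v
  point x = x mod v

  develop : ℕ → ℕ × ℕ × ℕ × ℕ × ℕ × ℕ → List (Trade v)
  develop n (a , b , c , d , e , f) = map translate (upTo n)
    where
    translate : ℕ → Trade v
    translate t = trade (point (t + a)) (point (t + b)) (point (t + c)) (point (t + d))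
                        (point (t + e)) (point (t + f))

  -- Translation by h = v/2 maps this base trade to itself with its two blocks exchanged,
  -- so its orbit has only h elements.
  shortOrbit : ℕ × ℕ × ℕ → List (Trade v)
  shortOrbit (h , c , e) = develop h (0 , h , c , e , c + h , e + h)

  fullOrbit : ℕ × ℕ × ℕ × ℕ × ℕ → List (Trade v)
  fullOrbit (d , c , e , c′ , e′) = develop v (0 , d , c , e , c′ + d , e′ + d)

  trades : (ℕ × ℕ × ℕ) × List (ℕ × ℕ × ℕ × ℕ × ℕ) → List (Trade v)
  trades (short , full) = shortOrbit short ++ concatMap fullOrbit full

baseTrades64 baseTrades100 baseTrades112 : (ℕ × ℕ × ℕ) × List (ℕ × ℕ × ℕ × ℕ × ℕ)
baseTrades64 = (32 , 42 , 17) , (48 , 46 , 13 , 3 , 34) ∷ (26 , 12 , 40 , 15 , 61) ∷ (39 , 36 , 35 , 32 , 30) ∷ (8 , 12 , 55 , 13 , 8) ∷ (6 , 10 , 24 , 9 , 51) ∷ (7 , 24 , 33 , 27 , 47) ∷ (19 , 38 , 11 , 6 , 33) ∷ (5 , 53 , 55 , 53 , 49) ∷ (23 , 45 , 3 , 20 , 21) ∷ (35 , 1 , 37 , 40 , 28) ∷ []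
baseTrades100 = (50 , 91 , 8) , (98 , 14 , 79 , 36 , 20) ∷ (96 , 95 , 52 , 66 , 45) ∷ (64 , 85 , 93 , 23 , 30) ∷ (77 , 66 , 72 , 37 , 13) ∷ (52 , 55 , 5 , 31 , 76) ∷ (26 , 16 , 27 , 47 , 86) ∷ (53 , 88 , 9 , 10 , 77) ∷ (57 , 18 , 82 , 67 , 78) ∷ (94 , 82 , 68 , 44 , 68) ∷ (96 , 28 , 97 , 91 , 33) ∷ (27 , 98 , 69 , 22 , 32) ∷ (83 , 37 , 2 , 72 , 92) ∷ (78 , 93 , 39 , 70 , 3) ∷ (51 , 60 , 40 , 7 , 19) ∷ (46 , 80 , 43 , 92 , 5) ∷ (40 , 84 , 15 , 59 , 85) ∷ []
baseTrades112 = (56 , 88 , 82) , (106 , 2 , 54 , 76 , 94) ∷ (53 , 34 , 67 , 79 , 25) ∷ (27 , 58 , 36 , 29 , 19) ∷ (29 , 68 , 28 , 100 , 89) ∷ (7 , 30 , 54 , 27 , 45) ∷ (41 , 105 , 42 , 40 , 99) ∷ (42 , 26 , 7 , 82 , 38) ∷ (104 , 32 , 49 , 51 , 75) ∷ (81 , 4 , 19 , 44 , 10) ∷ (10 , 63 , 83 , 77 , 4) ∷ (47 , 50 , 30 , 37 , 109) ∷ (16 , 12 , 85 , 92 , 45) ∷ (76 , 61 , 99 , 91 , 41) ∷ (9 , 107 , 57 , 94 , 51) ∷ (101 , 100 , 86 , 66 , 33) ∷ (22 , 35 , 37 , 21 , 95) ∷ (64 , 89 , 110 , 16 , 11) ∷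 (3 , 74 , 66 , 110 , 84) ∷ []

lemma8 : ∀ (v : ℕ) → v ≡ 64 ⊎ v ≡ 100 ⊎ v ≡ 112 →
    Σ (List (Block v)) (λ B → IsDD v B × SuperSimple B × HalfDefining v B)
lemma8 _ (inj₁ refl) = design-from-checks (CyclicDevelopment.trades 64 baseTrades64) refl refl refl
lemma8 _ (inj₂ (inj₁ refl)) = design-from-checks (CyclicDevelopment.trades 100 baseTrades100) refl refl refl
lemma8 _ (inj₂ (inj₂ refl)) = design-from-checks (CyclicDevelopment.trades 112 baseTrades112) refl refl refl
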